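{- Let $G$ be a nontrivial finite abelian group. Then \[ \mathsf{D}^{\ast}_{\pm}(G) \le \mathsf{D}_{\pm}(G) \le \mathsf{D}^{\ast}_{\pm}(G) + \operatorname{rank}(G) - 1. \]
   Context: $C_m$ denotes a cyclic group of order $m$. For a nontrivial finite abelian group $G \cong C_{n_1}\oplus\dots\oplus C_{n_r}$ with $1 < n_1 \mid \dots \mid n_r$, $\operatorname{rank}(G) = r$. For a finite abelian group $G$ (written additively), the plus-minus weighted Davenport constant $\mathsf{D}_{\pm}(G)$ is the smallest positive integer $\ell$ such that for every sequence $g_1,\dots,g_k$ of elements of $G$ (repetitions allowed) with $k \ge \ell$ there exist a non-empty subset $I \subset \{1,\dots,k\}$ and $a_i \in \{+1,-1\}$ ($i\in I$) with $\sum_{i \in I} a_i g_i = 0$. Further, \[ \mathsf{D}^{\ast}_{\pm}(G) = \max\Big\{ \sum_{i=1}^t \lfloor \log_2 m_i \rfloor + 1 \colon G \cong \bigoplus_{i=1}^t C_{m_i},\ t, m_i \in \mathbb{N} \Big\} \] (cyclic summands of order $1$ are allowed). -}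

module Defs where

open import Level using (Level; _⊔_)
open import Algebra.Bundles using (AbelianGroup)
open import Data.Nat using (ℕ; zero; suc; _+_; _≤_)
open import Data.Nat.Logarithm using (⌊log₂_⌋)
open import Data.Fin using (Fin; zero; suc)
open import Data.Integer as ℤ using (ℤ; +_; _-_)
open import Data.Integer.Divisibility using (_∣_)
open import Data.Product using (Σ; ∃; _×_)
open import Relation.Binary.PropositionalEquality using (_≡_)

sumℕ : (t : ℕ) → (Fin t → ℕ) → ℕ
sumℕ zero    f = 0
sumℕ (suc t) f = f zero + sumℕ t (λ i → f (suc i))

-- Elements of C_{m_0} ⊕ ... ⊕ C_{m_{t-1}} are represented by integer vectors
-- Fin t → ℤ, with x ≡ y in the group iff m_i ∣ x_i - y_i for every i,
-- i.e. the group is ℤ^t / (m_0 ℤ ⊕ ... ⊕ m_{t-1} ℤ).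
_≋[_]_ : {t : ℕ} → (Fin t → ℤ) → (Fin t → ℕ) → (Fin t → ℤ) → Set
x ≋[ m ] y = ∀ i → (+ m i) ∣ (x i - y i)

module _ {c ℓ : Level} (G : AbelianGroup c ℓ) where
  open AbelianGroup G

  record Iso (t : ℕ) (m : Fin t → ℕ) : Set (c ⊔ ℓ) where
    field
      f        : Carrier → (Fin t → ℤ)
      f-cong   : ∀ {x y} → x ≈ y → f x ≋[ m ] f y
      f-hom    : ∀ x y → f (x ∙ y) ≋[ m ] (λ i → f x i ℤ.+ f y i)
      f-inj    : ∀ {x y} → f x ≋[ m ] f y → x ≈ y
      f-surj   : ∀ v → Σ Carrier (λ x → f x ≋[ m ] v)

  -- Signs: coefficients in {-1, 0, +1}; `none` means "index not in I".
  data Sign : Set where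
    minus none plus : Sign

  act : Sign → Carrier → Carrier
  act minus g = g ⁻¹
  act none  g = ε
  act plus  g = g

  wsum : (k : ℕ) → (Fin k → Sign) → (Fin k → Carrier) → Carrier
  wsum zero    a g = ε
  wsum (suc k) a g = act (a zero) (g zero) ∙ wsum k (λ i → a (suc i)) (λ i → g (suc i))

  NonEmpty : {k : ℕ} → (Fin k → Sign) → Set
  NonEmpty {k} a = ∃ λ (i : Fin k) → (a i ≡ minus) Data.Sum.⊎ (a i ≡ plus)
    where import Data.Sum

  PMProperty : ℕ → Set (c ⊔ ℓ)
  PMProperty l = ∀ k → l ≤ k → (g : Fin k → Carrier) →
                 ∃ λ (a : Fin k → Sign) → NonEmpty a × (wsum k a g ≈ ε)

  IsDpm : ℕ → Set (c ⊔ ℓ)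
  IsDpm D = (1 ≤ D) × PMProperty D × (∀ l → 1 ≤ l → PMProperty l → D ≤ l)

  logSum : (t : ℕ) → (Fin t → ℕ) → ℕ
  logSum t m = sumℕ t (λ i → ⌊log₂ m i ⌋) + 1

  IsDstar : ℕ → Set (c ⊔ ℓ)
  IsDstar d = (∃ λ t → ∃ λ (m : Fin t → ℕ) → (∀ i → 1 ≤ m i) × Iso t m × (logSum t m ≡ d))
            × (∀ t (m : Fin t → ℕ) → (∀ i → 1 ≤ m i) → Iso t m → logSum t m ≤ d)

{-# OPTIONS --safe #-}
module Submission where

-- Fix a decomposition G ≅ C_{m₀} ⊕ ⋯ ⊕ C_{m_{t-1}}. The Σᵢ ⌊log₂ mᵢ⌋ elements 2ʲ·eᵢ (j < ⌊log₂ mᵢ⌋)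
-- have no nonempty ±-weighted zero sum: in coordinate i such a sum is a signed binary number of
-- absolute value below 2^⌊log₂ mᵢ⌋ ≤ mᵢ, so it vanishes only when all its digits do; hence D*± ≤ D±.
-- Conversely |G| = ∏ nᵢ < 2^Σ(⌊log₂ nᵢ⌋ + 1), so in a sequence of that length two subset sums coincide
-- and their difference is a ±-weighted zero sum; hence D± ≤ D*± + r − 1. Both constants exist because
-- G is finite: enumerating G decides the ±-property, and a decomposition is determined by the finite
-- table of coordinates it assigns to the elements of G, so D*± is the largest value of a decidable,
-- bounded predicate.

open import Defs
open import Level using (Level; 0ℓ; _⊔_)
open import Algebra.Bundles using (AbelianGroup)
open import Data.Nat as ℕ using (ℕ; zero; suc; _+_; _*_; _^_; _∸_; _≤_; _<_; z≤n; s≤s; NonZero)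
import Data.Nat.Properties as ℕ
import Data.Nat.Divisibility as ℕ
open import Data.Nat.Divisibility using (_∣_)
open import Data.Fin as Fin using (Fin; zero; suc; toℕ)
import Data.Fin.Properties as Fin
open import Data.Nat.Logarithm using (⌊log₂_⌋; ⌊log₂⌋-mono-≤; ⌊log₂⌊n/2⌋⌋≡⌊log₂n⌋∸1; ⌊log₂[2^n]⌋≡n)
open import Data.Nat.Induction using (<-rec)
open import Data.Integer as ℤ using (ℤ; +_)
import Data.Integer.Properties as ℤ
open import Data.Integer.DivMod using (_%ℕ_; _/ℕ_; n%ℕd<d; a≡a%ℕn+[a/ℕn]*n)
open import Data.Integer.Divisibility.Signed as ℤ∣ using (divides; ∣ᵤ⇒∣; ∣⇒∣ᵤ)
open import Data.Integer.Divisibility using () renaming (_∣_ to _∣ᵤ_)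
open import Data.Integer.Tactic.RingSolver using (solve-∀)
open import Algebra.Properties.CommutativeMonoid.Sum ℤ.+-0-commutativeMonoid
  using (sum; sum-cong-≗; sum-replicate-zero)
open import Data.Vec.Functional using (_∷_; _++_; replicate; removeAt; insertAt)
open import Data.Vec.Functional.Properties using (lookup-++ˡ; lookup-++ʳ; insertAt-punchIn)
open import Algebra.Properties.Semiring.Sum ℤ.+-*-semiring using (*-distribˡ-sum)
open import Data.Sum as Sum using (_⊎_; inj₁; inj₂)
open import Data.Product using (Σ; ∃; _×_; _,_; proj₁; proj₂)
open import Relation.Binary using (Setoid; IsEquivalence)
import Relation.Binary.Reasoning.Setoid as ≈-Reasoning
open import Relation.Binary.PropositionalEquality
open import Relation.Nullary using (¬_; Dec; yes; no)
import Relation.Nullary.Decidable as Dec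
open import Relation.Nullary.Decidable using (_×-dec_; _→-dec_)
import Relation.Unary as U
open import Function using (_∘_)
open import Data.Empty using (⊥-elim)

⌈n/2⌉≤1+⌊n/2⌋ : ∀ n → ℕ.⌈ n /2⌉ ≤ suc ℕ.⌊ n /2⌋
⌈n/2⌉≤1+⌊n/2⌋ zero          = z≤n
⌈n/2⌉≤1+⌊n/2⌋ (suc zero)    = ℕ.≤-refl
⌈n/2⌉≤1+⌊n/2⌋ (suc (suc n)) = s≤s (⌈n/2⌉≤1+⌊n/2⌋ n)

1≤⌊log₂⌋ : ∀ {n} → 2 ≤ n → 1 ≤ ⌊log₂ n ⌋
1≤⌊log₂⌋ {n} 2≤n = subst (_≤ ⌊log₂ n ⌋) (⌊log₂[2^n]⌋≡n 1) (⌊log₂⌋-mono-≤ 2≤n)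

⌊log₂n⌋≡1+⌊log₂⌊n/2⌋⌋ : ∀ n → 2 ≤ n → ⌊log₂ n ⌋ ≡ suc ⌊log₂ ℕ.⌊ n /2⌋ ⌋
⌊log₂n⌋≡1+⌊log₂⌊n/2⌋⌋ n 2≤n = begin
  ⌊log₂ n ⌋               ≡⟨ ℕ.m+[n∸m]≡n (1≤⌊log₂⌋ 2≤n) ⟨
  suc (⌊log₂ n ⌋ ∸ 1)     ≡⟨ cong suc (⌊log₂⌊n/2⌋⌋≡⌊log₂n⌋∸1 n) ⟨
  suc ⌊log₂ ℕ.⌊ n /2⌋ ⌋   ∎
  where open ≡-Reasoning

2^⌊log₂n⌋≤n : ∀ n → 1 ≤ n → 2 ^ ⌊log₂ n ⌋ ≤ n
2^⌊log₂n⌋≤n = <-rec _ bound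
  where
  bound : ∀ n → (∀ {m} → m < n → 1 ≤ m → 2 ^ ⌊log₂ m ⌋ ≤ m) → 1 ≤ n → 2 ^ ⌊log₂ n ⌋ ≤ n
  bound (suc zero)      _   _ = ℕ.≤-refl
  bound n@(suc (suc k)) rec _ = begin
    2 ^ ⌊log₂ n ⌋          ≡⟨ cong (2 ^_) (⌊log₂n⌋≡1+⌊log₂⌊n/2⌋⌋ n (s≤s (s≤s z≤n))) ⟩
    2 * 2 ^ ⌊log₂ h ⌋      ≤⟨ ℕ.*-monoʳ-≤ 2 (rec (ℕ.⌊n/2⌋<n (suc k)) (s≤s z≤n)) ⟩
    h + (h + 0)            ≤⟨ ℕ.+-monoʳ-≤ h (ℕ.≤-trans (ℕ.≤-reflexive (ℕ.+-identityʳ h)) (ℕ.⌊n/2⌋≤⌈n/2⌉ n)) ⟩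
    h + ℕ.⌈ n /2⌉          ≡⟨ ℕ.⌊n/2⌋+⌈n/2⌉≡n n ⟩
    n                      ∎
    where
    open ℕ.≤-Reasoning
    h = ℕ.⌊ n /2⌋

n<2^[1+⌊log₂n⌋] : ∀ n → n < 2 ^ suc ⌊log₂ n ⌋
n<2^[1+⌊log₂n⌋] = <-rec _ bound
  where
  bound : ∀ n → (∀ {m} → m < n → m < 2 ^ suc ⌊log₂ m ⌋) → n < 2 ^ suc ⌊log₂ n ⌋
  bound zero            _   = s≤s z≤n
  bound (suc zero)      _   = s≤s (s≤s z≤n)
  bound n@(suc (suc k)) rec = begin-strict
    n                           ≡⟨ ℕ.⌊n/2⌋+⌈n/2⌉≡n n ⟨
    h + ℕ.⌈ n /2⌉               ≤⟨ ℕ.+-monoʳ-≤ h (⌈n/2⌉≤1+⌊n/2⌋ n) ⟩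
    h + suc h                   <⟨ ℕ.+-monoˡ-< (suc h) (ℕ.n<1+n h) ⟩
    suc h + suc h               ≡⟨ cong (λ x → suc h + x) (ℕ.+-identityʳ (suc h)) ⟨
    suc h + (suc h + 0)         ≤⟨ ℕ.*-monoʳ-≤ 2 (rec (ℕ.⌊n/2⌋<n (suc k))) ⟩
    2 * 2 ^ suc ⌊log₂ h ⌋       ≡⟨ cong (λ e → 2 ^ suc e) (⌊log₂n⌋≡1+⌊log₂⌊n/2⌋⌋ n (s≤s (s≤s z≤n))) ⟨
    2 ^ suc ⌊log₂ n ⌋           ∎
    where
    open ℕ.≤-Reasoning
    h = ℕ.⌊ n /2⌋

Σ⌊log₂⌋ : (t : ℕ) → (Fin t → ℕ) → ℕ
Σ⌊log₂⌋ t m = sumℕ t (λ i → ⌊log₂ m i ⌋)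

∏ : (t : ℕ) → (Fin t → ℕ) → ℕ
∏ zero    a = 1
∏ (suc t) a = a zero * ∏ t (a ∘ suc)

∏-positive : ∀ t {a} → (∀ i → 1 ≤ a i) → 1 ≤ ∏ t a
∏-positive zero    _     = ℕ.≤-refl
∏-positive (suc t) 1≤a = ℕ.*-mono-≤ (1≤a zero) (∏-positive t (1≤a ∘ suc))

∏-≥-factor : ∀ t {a} → (∀ i → 1 ≤ a i) → ∀ i → a i ≤ ∏ t a
∏-≥-factor (suc t) {a} 1≤a zero    = ℕ.m≤m*n (a zero) (∏ t (a ∘ suc)) {{ℕ.>-nonZero (∏-positive t (1≤a ∘ suc))}}
∏-≥-factor (suc t) {a} 1≤a (suc i) = ℕ.≤-trans (∏-≥-factor t (1≤a ∘ suc) i) (ℕ.m≤n*m _ (a zero) {{ℕ.>-nonZero (1≤a zero)}})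

∏-mono-≤ : ∀ t {a b} → (∀ i → a i ≤ b i) → ∏ t a ≤ ∏ t b
∏-mono-≤ zero    _   = ℕ.≤-refl
∏-mono-≤ (suc t) a≤b = ℕ.*-mono-≤ (a≤b zero) (∏-mono-≤ t (a≤b ∘ suc))

∏-mono-< : ∀ t {a b} → 1 ≤ t → (∀ i → a i < b i) → ∏ t a < ∏ t b
∏-mono-< (suc t) {a} {b} _ a<b = begin-strict
  a zero * ∏ t (a ∘ suc)  ≤⟨ ℕ.*-monoʳ-≤ (a zero) (∏-mono-≤ t (ℕ.<⇒≤ ∘ a<b ∘ suc)) ⟩
  a zero * ∏ t (b ∘ suc)  <⟨ ℕ.*-monoˡ-< (∏ t (b ∘ suc)) {{∏b≢0}} (a<b zero) ⟩
  b zero * ∏ t (b ∘ suc)  ∎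
  where
  open ℕ.≤-Reasoning
  ∏b≢0 : NonZero (∏ t (b ∘ suc))
  ∏b≢0 = ℕ.>-nonZero (∏-positive t (λ i → ℕ.≤-trans (s≤s z≤n) (a<b (suc i))))

∏-2^ : ∀ t (e : Fin t → ℕ) → ∏ t (λ i → 2 ^ e i) ≡ 2 ^ sumℕ t e
∏-2^ zero    e = refl
∏-2^ (suc t) e = trans (cong (2 ^ e zero *_) (∏-2^ t (e ∘ suc))) (sym (ℕ.^-distribˡ-+-* 2 (e zero) _))

∏-combine : ∀ t {m : Fin t → ℕ} → ((i : Fin t) → Fin (m i)) → Fin (∏ t m)
∏-combine zero    w = zero
∏-combine (suc t) w = Fin.combine (w zero) (∏-combine t (w ∘ suc))

∏-combine-injective : ∀ t {m : Fin t → ℕ} (u w : (i : Fin t) → Fin (m i)) →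
                      ∏-combine t u ≡ ∏-combine t w → ∀ i → u i ≡ w i
∏-combine-injective (suc t) u w eq zero    = proj₁ (Fin.combine-injective (u zero) _ (w zero) _ eq)
∏-combine-injective (suc t) u w eq (suc i) =
  ∏-combine-injective t (u ∘ suc) (w ∘ suc) (proj₂ (Fin.combine-injective (u zero) _ (w zero) _ eq)) i

sumℕ-cong : ∀ t {a b : Fin t → ℕ} → (∀ i → a i ≡ b i) → sumℕ t a ≡ sumℕ t b
sumℕ-cong zero    _   = refl
sumℕ-cong (suc t) a≗b = cong₂ _+_ (a≗b zero) (sumℕ-cong t (a≗b ∘ suc))

sumℕ-suc : ∀ t (a : Fin t → ℕ) → sumℕ t (λ i → suc (a i)) ≡ sumℕ t a + t
sumℕ-suc zero    a = refl
sumℕ-suc (suc t) a = begin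
  suc (a zero + sumℕ t (λ i → suc (a (suc i))))  ≡⟨ cong (λ s → suc (a zero + s)) (sumℕ-suc t (a ∘ suc)) ⟩
  suc (a zero + (sumℕ t (a ∘ suc) + t))          ≡⟨ cong suc (ℕ.+-assoc (a zero) _ t) ⟨
  suc (a zero + sumℕ t (a ∘ suc) + t)            ≡⟨ ℕ.+-suc _ t ⟨
  a zero + sumℕ t (a ∘ suc) + suc t              ∎
  where open ≡-Reasoning

sumℕ-removeAt : ∀ t (a : Fin (suc t) → ℕ) i → sumℕ (suc t) a ≡ a i + sumℕ t (a ∘ Fin.punchIn i)
sumℕ-removeAt t       a zero    = refl
sumℕ-removeAt (suc t) a (suc i) = begin
  a zero + sumℕ (suc t) (a ∘ suc)                           ≡⟨ cong (λ s → a zero + s) (sumℕ-removeAt t (a ∘ suc) i) ⟩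
  a zero + (a (suc i) + sumℕ t (a ∘ suc ∘ Fin.punchIn i))   ≡⟨ ℕ.+-comm (a zero) _ ⟩
  a (suc i) + sumℕ t (a ∘ suc ∘ Fin.punchIn i) + a zero     ≡⟨ ℕ.+-assoc (a (suc i)) _ _ ⟩
  a (suc i) + (sumℕ t (a ∘ suc ∘ Fin.punchIn i) + a zero)   ≡⟨ cong (λ s → a (suc i) + s) (ℕ.+-comm _ (a zero)) ⟩
  a (suc i) + (a zero + sumℕ t (a ∘ suc ∘ Fin.punchIn i))   ∎
  where open ≡-Reasoning

sumℕ-≥-length : ∀ t {a : Fin t → ℕ} → (∀ i → 1 ≤ a i) → t ≤ sumℕ t a
sumℕ-≥-length zero    _   = z≤n
sumℕ-≥-length (suc t) 1≤a = ℕ.+-mono-≤ (1≤a zero) (sumℕ-≥-length t (1≤a ∘ suc))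

Least Greatest : ∀ {p} → (ℕ → Set p) → ℕ → Set p
Least    P k = P k × (∀ {j} → P j → k ≤ j)
Greatest P k = P k × (∀ {j} → P j → j ≤ k)

least : ∀ {p} {P : ℕ → Set p} → U.Decidable P → ∀ {n} → P n → ∃ (Least P)
least {P = P} P? {n} = <-rec (λ n → P n → ∃ (Least P)) search n
  where
  search : ∀ n → (∀ {m} → m < n → P m → ∃ (Least P)) → P n → ∃ (Least P)
  search n below Pn with ℕ.anyUpTo? P? n
  ... | yes (m , m<n , Pm) = below m<n Pm
  ... | no  ¬smaller       = n , Pn , λ Pj → ℕ.≮⇒≥ (λ j<n → ¬smaller (_ , j<n , Pj))

greatest : ∀ {p} {P : ℕ → Set p} → U.Decidable P → ∀ {n B} → P n → (∀ {j} → P j → j ≤ B) → ∃ (Greatest P)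
greatest {P = P} P? {n} {B} Pn bounded = B ∸ k , P[B∸k] , maximal
  where
  reflect : ∀ {j} → P j → P (B ∸ (B ∸ j))
  reflect {j} Pj = subst P (sym (ℕ.m∸[m∸n]≡n (bounded Pj))) Pj
  minimal = least (λ j → P? (B ∸ j)) {B ∸ n} (reflect Pn)
  k = proj₁ minimal
  P[B∸k] = proj₁ (proj₂ minimal)
  maximal : ∀ {j} → P j → j ≤ B ∸ k
  maximal {j} Pj = subst (_≤ B ∸ k) (ℕ.m∸[m∸n]≡n (bounded Pj))
                     (ℕ.∸-monoʳ-≤ B (proj₂ (proj₂ minimal) {B ∸ j} (reflect Pj)))

funToFin-cong : ∀ {k n} {u v : Fin k → Fin n} → (∀ i → u i ≡ v i) → Fin.funToFin u ≡ Fin.funToFin v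
funToFin-cong {zero}  _   = refl
funToFin-cong {suc k} u≗v = cong₂ Fin.combine (u≗v zero) (funToFin-cong (u≗v ∘ suc))

finToFun-injective : ∀ {k n} {x y : Fin (n ^ k)} → (∀ i → Fin.finToFun {n} {k} x i ≡ Fin.finToFun y i) → x ≡ y
finToFun-injective {k} {n} {x} {y} x≗y = begin
  x                                             ≡⟨ Fin.funToFin-finToFin {k} {n} x ⟨
  Fin.funToFin (Fin.finToFun {n} {k} x)         ≡⟨ funToFin-cong {u = Fin.finToFun {n} {k} x} x≗y ⟩
  Fin.funToFin (Fin.finToFun {n} {k} y)         ≡⟨ Fin.funToFin-finToFin {k} {n} y ⟩
  y                                             ∎
  where open ≡-Reasoning

infix 4 _≡[_]_
record _≡[_]_ (a : ℤ) (m : ℕ) (b : ℤ) : Set where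
  constructor mod
  field divides-difference : + m ℤ∣.∣ a ℤ.- b

module _ {m : ℕ} where

  ≡[]-reflexive : ∀ {a b} → a ≡ b → a ≡[ m ] b
  ≡[]-reflexive {a} refl = mod (subst (+ m ℤ∣.∣_) (sym (ℤ.+-inverseʳ a)) (divides (+ 0) refl))

  ≡[]-refl : ∀ {a} → a ≡[ m ] a
  ≡[]-refl = ≡[]-reflexive refl

  ≡[]-sym : ∀ {a b} → a ≡[ m ] b → b ≡[ m ] a
  ≡[]-sym {a} {b} (mod p) = mod (subst (+ m ℤ∣.∣_) (swap a b) (ℤ∣.∣m⇒∣-m p))
    where
    swap : ∀ a b → ℤ.- (a ℤ.- b) ≡ b ℤ.- a
    swap = solve-∀

  ≡[]-trans : ∀ {a b c} → a ≡[ m ] b → b ≡[ m ] c → a ≡[ m ] c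
  ≡[]-trans {a} {b} {c} (mod p) (mod q) = mod (subst (+ m ℤ∣.∣_) (telescope a b c) (ℤ∣.∣m∣n⇒∣m+n p q))
    where
    telescope : ∀ a b c → (a ℤ.- b) ℤ.+ (b ℤ.- c) ≡ a ℤ.- c
    telescope = solve-∀

  ≡[]-isEquivalence : IsEquivalence _≡[ m ]_
  ≡[]-isEquivalence = record { refl = ≡[]-refl ; sym = ≡[]-sym ; trans = ≡[]-trans }

  +-cong-≡[] : ∀ {a b c d} → a ≡[ m ] b → c ≡[ m ] d → a ℤ.+ c ≡[ m ] b ℤ.+ d
  +-cong-≡[] {a} {b} {c} {d} (mod p) (mod q) = mod (subst (+ m ℤ∣.∣_) (regroup a b c d) (ℤ∣.∣m∣n⇒∣m+n p q))
    where
    regroup : ∀ a b c d → (a ℤ.- b) ℤ.+ (c ℤ.- d) ≡ (a ℤ.+ c) ℤ.- (b ℤ.+ d)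
    regroup = solve-∀

  +-congˡ-≡[] : ∀ c {a b} → a ≡[ m ] b → c ℤ.+ a ≡[ m ] c ℤ.+ b
  +-congˡ-≡[] c = +-cong-≡[] {c} {c} ≡[]-refl

  +-congʳ-≡[] : ∀ c {a b} → a ≡[ m ] b → a ℤ.+ c ≡[ m ] b ℤ.+ c
  +-congʳ-≡[] c a≡b = +-cong-≡[] {c = c} {c} a≡b ≡[]-refl

  *-congˡ-≡[] : ∀ c {a b} → a ≡[ m ] b → c ℤ.* a ≡[ m ] c ℤ.* b
  *-congˡ-≡[] c {a} {b} (mod p) = mod (subst (+ m ℤ∣.∣_) (factor c a b) (ℤ∣.∣n⇒∣m*n c p))
    where
    factor : ∀ c a b → c ℤ.* (a ℤ.- b) ≡ c ℤ.* a ℤ.- c ℤ.* b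
    factor = solve-∀

  multiple-≡[]0 : ∀ q → q ℤ.* + m ≡[ m ] + 0
  multiple-≡[]0 q = mod (divides q (ℤ.+-identityʳ (q ℤ.* + m)))

  ≡[]0⇒∣ : ∀ {a} → a ≡[ m ] + 0 → m ℕ.∣ ℤ.∣ a ∣
  ≡[]0⇒∣ {a} (mod p) = ∣⇒∣ᵤ (subst (+ m ℤ∣.∣_) (ℤ.+-identityʳ a) p)

  ≡[]0∧small⇒≡0 : ∀ {a} → a ≡[ m ] + 0 → ℤ.∣ a ∣ < m → a ≡ + 0
  ≡[]0∧small⇒≡0 {a} a≡0 a<m with ℤ.∣ a ∣ in ∣a∣≡ | ≡[]0⇒∣ a≡0
  ... | zero  | _   = ℤ.∣i∣≡0⇒i≡0 ∣a∣≡
  ... | suc _ | m∣a = ⊥-elim (ℕ.>⇒∤ a<m m∣a)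

a≡a+b-b : ∀ a b → a ≡ a ℤ.+ b ℤ.- b
a≡a+b-b = solve-∀

≡[]-setoid : ℕ → Setoid 0ℓ 0ℓ
≡[]-setoid m = record { isEquivalence = ≡[]-isEquivalence {m} }

≡[]-canonical : ∀ {m a b} → + a ≡[ m ] + b → a < m → b < m → a ≡ b
≡[]-canonical {m} {a} {b} a≡b a<m b<m =
  ℤ.+-injective (ℤ.i-j≡0⇒i≡j (+ a) (+ b) (≡[]0∧small⇒≡0 difference≡0 difference<m))
  where
  difference≡0 : + a ℤ.- + b ≡[ m ] + 0
  difference≡0 = begin
    + a ℤ.- + b ≈⟨ +-congʳ-≡[] (ℤ.- + b) a≡b ⟩
    + b ℤ.- + b ≡⟨ ℤ.+-inverseʳ (+ b) ⟩
    + 0         ∎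
    where open ≈-Reasoning (≡[]-setoid m)
  difference<m : ℤ.∣ + a ℤ.- + b ∣ < m
  difference<m = subst (_< m) (cong ℤ.∣_∣ (sym (ℤ.m-n≡m⊖n a b)))
                   (ℕ.≤-<-trans (ℤ.∣m⊝n∣≤m⊔n a b) (ℕ.⊔-lub a<m b<m))

residue : ∀ {m N} → 1 ≤ m → m ≤ N → (a : ℤ) → Σ (Fin N) λ w → + toℕ w ≡[ m ] a
residue {m} {N} 1≤m m≤N a =
  Fin.fromℕ< r<N , subst (λ k → + k ≡[ m ] a) (sym (Fin.toℕ-fromℕ< r<N)) r≡a
  where
  instance
    m≢0 : NonZero m
    m≢0 = ℕ.>-nonZero 1≤m
  r<N : a %ℕ m < N
  r<N = ℕ.<-≤-trans (n%ℕd<d a m) m≤N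
  r≡a : + (a %ℕ m) ≡[ m ] a
  r≡a = ≡[]-sym (begin
    a                                  ≡⟨ a≡a%ℕn+[a/ℕn]*n a m ⟩
    + (a %ℕ m) ℤ.+ (a /ℕ m) ℤ.* + m    ≈⟨ +-congˡ-≡[] (+ (a %ℕ m)) (multiple-≡[]0 (a /ℕ m)) ⟩
    + (a %ℕ m) ℤ.+ + 0                 ≡⟨ ℤ.+-identityʳ _ ⟩
    + (a %ℕ m)                         ∎)
    where open ≈-Reasoning (≡[]-setoid m)

⟦_⟧ : ∀ {t N} → (Fin t → Fin N) → Fin t → ℤ
⟦ w ⟧ i = + toℕ (w i)

infixl 6 _+ᵛ_
_+ᵛ_ : ∀ {t} → (Fin t → ℤ) → (Fin t → ℤ) → Fin t → ℤ
(x +ᵛ y) i = x i ℤ.+ y i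

module _ {t : ℕ} {m : Fin t → ℕ} where

  ≋⇒≡[] : ∀ {x y} → x ≋[ m ] y → ∀ i → x i ≡[ m i ] y i
  ≋⇒≡[] x≋y i = mod (∣ᵤ⇒∣ (x≋y i))

  ≡[]⇒≋ : ∀ {x y} → (∀ i → x i ≡[ m i ] y i) → x ≋[ m ] y
  ≡[]⇒≋ x≡y i = ∣⇒∣ᵤ (_≡[_]_.divides-difference (x≡y i))

  ≋-reflexive : ∀ {x y} → (∀ i → x i ≡ y i) → x ≋[ m ] y
  ≋-reflexive x≗y = ≡[]⇒≋ (λ i → ≡[]-reflexive (x≗y i))

  ≋-isEquivalence : IsEquivalence (λ x y → x ≋[ m ] y)
  ≋-isEquivalence = record
    { refl  = λ {x} → ≋-reflexive {x} {x} (λ _ → refl)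
    ; sym   = λ {x} {y} x≋y → ≡[]⇒≋ (λ i → ≡[]-sym (≋⇒≡[] {x} {y} x≋y i))
    ; trans = λ {x} {y} {z} x≋y y≋z → ≡[]⇒≋ (λ i → ≡[]-trans (≋⇒≡[] {x} {y} x≋y i) (≋⇒≡[] {y} {z} y≋z i))
    }

  +ᵛ-cong-≋ : ∀ {x y u v} → x ≋[ m ] y → u ≋[ m ] v → (x +ᵛ u) ≋[ m ] (y +ᵛ v)
  +ᵛ-cong-≋ {x} {y} {u} {v} x≋y u≋v = ≡[]⇒≋ (λ i → +-cong-≡[] (≋⇒≡[] {x} {y} x≋y i) (≋⇒≡[] {u} {v} u≋v i))

  _≋?_ : ∀ x y → Dec (x ≋[ m ] y)
  x ≋? y = Fin.all? (λ i → m i ℕ.∣? ℤ.∣ x i ℤ.- y i ∣)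

  residues : ∀ {N} → (∀ i → 1 ≤ m i) → (∀ i → m i ≤ N) → (v : Fin t → ℤ) →
             Σ (Fin t → Fin N) λ w → ⟦ w ⟧ ≋[ m ] v
  residues 1≤m m≤N v = (λ i → proj₁ (r i)) , ≡[]⇒≋ (λ i → proj₂ (r i))
    where r = λ i → residue (1≤m i) (m≤N i) (v i)

≋-setoid : ∀ {t} → (Fin t → ℕ) → Setoid 0ℓ 0ℓ
≋-setoid m = record { isEquivalence = ≋-isEquivalence {m = m} }

≋-cong-modulus : ∀ {t} {m m′ : Fin t → ℕ} → (∀ i → m i ≡ m′ i) → ∀ {x y} → x ≋[ m ] y → x ≋[ m′ ] y
≋-cong-modulus m≗m′ {x} {y} x≋y i = subst (λ k → + k ∣ᵤ x i ℤ.- y i) (m≗m′ i) (x≋y i)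

sum-≡[] : ∀ {m} k {a b : Fin k → ℤ} → (∀ j → a j ≡[ m ] b j) → sum a ≡[ m ] sum b
sum-≡[] zero    _   = ≡[]-refl
sum-≡[] (suc k) a≡b = +-cong-≡[] (a≡b zero) (sum-≡[] k (a≡b ∘ suc))

sum-split : ∀ A B (h : Fin (A + B) → ℤ) → sum h ≡ sum (h ∘ (Fin._↑ˡ B)) ℤ.+ sum (h ∘ (A Fin.↑ʳ_))
sum-split zero    B h = sym (ℤ.+-identityˡ (sum h))
sum-split (suc A) B h = trans (cong (λ s → h zero ℤ.+ s) (sum-split A B (h ∘ suc))) (sym (ℤ.+-assoc (h zero) _ _))

sum-zero : ∀ k {h : Fin k → ℤ} → (∀ j → h j ≡ + 0) → sum h ≡ + 0
sum-zero k h≗0 = trans (sum-cong-≗ h≗0) (sum-replicate-zero k)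

-- Row k is 2ʲ·eᵢ, the pairs (i , j < L i) being listed block by block.
powerSequence : ∀ t (L : Fin t → ℕ) → Fin (sumℕ t L) → Fin t → ℤ
powerSequence zero    L ()
powerSequence (suc t) L = (λ j → + (2 ^ toℕ j) ∷ replicate t (+ 0)) ++ (λ k → + 0 ∷ powerSequence t (L ∘ suc) k)

module _ {c ℓ} (G : AbelianGroup c ℓ) where
  open AbelianGroup G renaming (refl to ≈-refl; sym to ≈-sym; trans to ≈-trans)
  open import Algebra.Properties.CommutativeSemigroup commutativeSemigroup using (interchange)
  open import Algebra.Properties.Group group using (identityˡ-unique)
  coefficient : Sign G → ℤ
  coefficient minus = ℤ.-1ℤ
  coefficient none  = + 0
  coefficient plus  = + 1

  ∣coefficient∣≤1 : ∀ s → ℤ.∣ coefficient s ∣ ≤ 1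
  ∣coefficient∣≤1 minus = ℕ.≤-refl
  ∣coefficient∣≤1 none  = z≤n
  ∣coefficient∣≤1 plus  = ℕ.≤-refl

  coefficient≡0⇒none : ∀ s → coefficient s ≡ + 0 → s ≡ none
  coefficient≡0⇒none none _ = refl

  combination : ∀ {k t} → (Fin k → Sign G) → (Fin k → Fin t → ℤ) → Fin t → ℤ
  combination a v i = sum (λ j → coefficient (a j) ℤ.* v j i)

  act-cong : ∀ s {x y} → x ≈ y → act G s x ≈ act G s y
  act-cong minus x≈y = ⁻¹-cong x≈y
  act-cong none  _   = ≈-refl
  act-cong plus  x≈y = x≈y

  wsum-cong : ∀ k a {g h : Fin k → Carrier} → (∀ j → g j ≈ h j) → wsum G k a g ≈ wsum G k a h
  wsum-cong zero    a _   = ≈-refl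
  wsum-cong (suc k) a g≈h = ∙-cong (act-cong (a zero) (g≈h zero)) (wsum-cong k (a ∘ suc) (g≈h ∘ suc))

  wsum-congˢ : ∀ k {a b : Fin k → Sign G} g → (∀ j → a j ≡ b j) → wsum G k a g ≡ wsum G k b g
  wsum-congˢ zero    g _   = refl
  wsum-congˢ (suc k) g a≗b = cong₂ _∙_ (cong (λ s → act G s (g zero)) (a≗b zero)) (wsum-congˢ k (g ∘ suc) (a≗b ∘ suc))

  NonEmpty-congˢ : ∀ {k} {a b : Fin k → Sign G} → (∀ j → a j ≡ b j) → NonEmpty G a → NonEmpty G b
  NonEmpty-congˢ a≗b (j , a[j]-signed) = j , Sum.map (trans (sym (a≗b j))) (trans (sym (a≗b j))) a[j]-signed

  NonEmpty⇒¬all-none : ∀ {k} {a : Fin k → Sign G} → NonEmpty G a → ¬ (∀ j → a j ≡ none)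
  NonEmpty⇒¬all-none (j , inj₁ a[j]≡minus) all-none with trans (sym (all-none j)) a[j]≡minus
  ... | ()
  NonEmpty⇒¬all-none (j , inj₂ a[j]≡plus) all-none with trans (sym (all-none j)) a[j]≡plus
  ... | ()

  wsum-∙ : ∀ k (a b c : Fin k → Sign G) g → (∀ j → act G (a j) (g j) ∙ act G (b j) (g j) ≈ act G (c j) (g j)) →
           wsum G k a g ∙ wsum G k b g ≈ wsum G k c g
  wsum-∙ zero    a b c g _   = identityˡ ε
  wsum-∙ (suc k) a b c g a+b≈c = ≈-trans (interchange _ _ _ _)
    (∙-cong (a+b≈c zero) (wsum-∙ k (a ∘ suc) (b ∘ suc) (c ∘ suc) (g ∘ suc) (a+b≈c ∘ suc)))

  module IsoProperties {t} {m : Fin t → ℕ} (J : Iso G t m) where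
    open Iso J

    f-cong-at : ∀ {x y} → x ≈ y → ∀ i → f x i ≡[ m i ] f y i
    f-cong-at {x} {y} x≈y = ≋⇒≡[] {x = f x} {f y} (f-cong x≈y)

    f-hom-at : ∀ x y i → f (x ∙ y) i ≡[ m i ] f x i ℤ.+ f y i
    f-hom-at x y = ≋⇒≡[] {x = f (x ∙ y)} {f x +ᵛ f y} (f-hom x y)

    f-inj-at : ∀ {x y} → (∀ i → f x i ≡[ m i ] f y i) → x ≈ y
    f-inj-at fx≡fy = f-inj (≡[]⇒≋ fx≡fy)

    f-ε : ∀ i → f ε i ≡[ m i ] + 0
    f-ε i = begin
      f ε i                         ≡⟨ a≡a+b-b (f ε i) (f ε i) ⟩
      f ε i ℤ.+ f ε i ℤ.- f ε i     ≈⟨ +-congʳ-≡[] (ℤ.- f ε i) (f-hom-at ε ε i) ⟨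
      f (ε ∙ ε) i ℤ.- f ε i         ≈⟨ +-congʳ-≡[] (ℤ.- f ε i) (f-cong-at (identityˡ ε) i) ⟩
      f ε i ℤ.- f ε i               ≡⟨ ℤ.+-inverseʳ (f ε i) ⟩
      + 0                           ∎
      where open ≈-Reasoning (≡[]-setoid (m i))

    f-⁻¹ : ∀ g i → f (g ⁻¹) i ≡[ m i ] ℤ.- f g i
    f-⁻¹ g i = begin
      f (g ⁻¹) i                          ≡⟨ a≡a+b-b (f (g ⁻¹) i) (f g i) ⟩
      f (g ⁻¹) i ℤ.+ f g i ℤ.- f g i      ≈⟨ +-congʳ-≡[] (ℤ.- f g i) (f-hom-at (g ⁻¹) g i) ⟨
      f (g ⁻¹ ∙ g) i ℤ.- f g i            ≈⟨ +-congʳ-≡[] (ℤ.- f g i) (≡[]-trans (f-cong-at (inverseˡ g) i) (f-ε i)) ⟩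
      + 0 ℤ.- f g i                       ≡⟨ ℤ.+-identityˡ (ℤ.- f g i) ⟩
      ℤ.- f g i                           ∎
      where open ≈-Reasoning (≡[]-setoid (m i))

    f-act : ∀ s g i → f (act G s g) i ≡[ m i ] coefficient s ℤ.* f g i
    f-act minus g i = ≡[]-trans (f-⁻¹ g i) (≡[]-reflexive (sym (ℤ.-1*i≡-i (f g i))))
    f-act none  g i = f-ε i
    f-act plus  g i = ≡[]-reflexive (sym (ℤ.*-identityˡ (f g i)))

    f-wsum : ∀ k a g i → f (wsum G k a g) i ≡[ m i ] combination a (f ∘ g) i
    f-wsum zero    a g i = f-ε i
    f-wsum (suc k) a g i = ≡[]-trans (f-hom-at _ _ i) (+-cong-≡[] (f-act (a zero) (g zero) i) (f-wsum k (a ∘ suc) (g ∘ suc) i))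

    section : (Fin t → ℤ) → Carrier
    section v = proj₁ (f-surj v)

    f-section : ∀ v i → f (section v) i ≡[ m i ] v i
    f-section v = ≋⇒≡[] {x = f (section v)} {v} (proj₂ (f-surj v))

    _≈?_ : ∀ x y → Dec (x ≈ y)
    x ≈? y = Dec.map′ f-inj f-cong (f x ≋? f y)

  Iso-transport : ∀ {t} {m m′ : Fin t → ℕ} → (∀ i → m i ≡ m′ i) → Iso G t m → Iso G t m′
  Iso-transport {m = m} {m′} m≗m′ J = record
    { f      = f
    ; f-cong = λ {x} {y} x≈y → ≋-cong-modulus m≗m′ {f x} {f y} (f-cong x≈y)
    ; f-hom  = λ x y → ≋-cong-modulus m≗m′ {f (x ∙ y)} {f x +ᵛ f y} (f-hom x y)
    ; f-inj  = λ {x} {y} fx≋fy → f-inj (≋-cong-modulus (sym ∘ m≗m′) {f x} {f y} fx≋fy)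
    ; f-surj = λ v → proj₁ (f-surj v) , ≋-cong-modulus m≗m′ {f (proj₁ (f-surj v))} {v} (proj₂ (f-surj v))
    }
    where open Iso J

  Iso-removeAt : ∀ {t} {m : Fin (suc t) → ℕ} → Iso G (suc t) m → ∀ i → m i ≡ 1 → Iso G t (removeAt m i)
  Iso-removeAt {t} {m} J i m[i]≡1 = record
    { f      = λ x → removeAt (f x) i
    ; f-cong = λ x≈y → f-cong x≈y ∘ Fin.punchIn i
    ; f-hom  = λ x y → f-hom x y ∘ Fin.punchIn i
    ; f-inj  = λ {x} {y} fx≋fy → f-inj (everywhere x y fx≋fy)
    ; f-surj = surj
    }
    where
    open Iso J
    surj : ∀ v → Σ Carrier λ x → removeAt (f x) i ≋[ removeAt m i ] v
    surj v = x , λ j → subst (λ a → + m (Fin.punchIn i j) ∣ᵤ f x (Fin.punchIn i j) ℤ.- a)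
                         (insertAt-punchIn v i (+ 0) j) (fx≋v (Fin.punchIn i j))
      where
      x = proj₁ (f-surj (insertAt v i (+ 0)))
      fx≋v = proj₂ (f-surj (insertAt v i (+ 0)))
    everywhere : ∀ x y → removeAt (f x) i ≋[ removeAt m i ] removeAt (f y) i → f x ≋[ m ] f y
    everywhere x y away-from-i k with k Fin.≟ i
    ... | yes refl = subst (λ q → q ℕ.∣ ℤ.∣ f x k ℤ.- f y k ∣) (sym m[i]≡1) (ℕ.1∣ _)
    ... | no  k≢i  = subst (λ k → + m k ∣ᵤ f x k ℤ.- f y k) (Fin.punchIn-punchOut (k≢i ∘ sym))
                       (away-from-i (Fin.punchOut (k≢i ∘ sym)))

  dropTrivialFactors : ∀ t (m : Fin t → ℕ) → Iso G t m → (∀ i → 1 ≤ m i) →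
    ∃ λ t′ → ∃ λ (m′ : Fin t′ → ℕ) → Iso G t′ m′ × (∀ i → 2 ≤ m′ i) × logSum G t′ m′ ≡ logSum G t m
  dropTrivialFactors zero    m J _ = zero , m , J , (λ ()) , refl
  dropTrivialFactors (suc t) m J 1≤m with Fin.any? (λ i → m i ℕ.≟ 1)
  ... | yes (i , m[i]≡1) =
    let t′ , m′ , J′ , 2≤m′ , same = dropTrivialFactors t (removeAt m i) (Iso-removeAt J i m[i]≡1) (1≤m ∘ Fin.punchIn i)
    in t′ , m′ , J′ , 2≤m′ , trans same (cong (λ s → s + 1) (sym (begin
      Σ⌊log₂⌋ (suc t) m                               ≡⟨ sumℕ-removeAt t (λ k → ⌊log₂ m k ⌋) i ⟩
      ⌊log₂ m i ⌋ + Σ⌊log₂⌋ t (removeAt m i)          ≡⟨ cong (λ q → ⌊log₂ q ⌋ + Σ⌊log₂⌋ t (removeAt m i)) m[i]≡1 ⟩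
      Σ⌊log₂⌋ t (removeAt m i)                        ∎)))
    where open ≡-Reasoning
  ... | no  no-trivial = suc t , m , J , 2≤m , refl
    where
    2≤m : ∀ i → 2 ≤ m i
    2≤m i = ℕ.≤∧≢⇒< (1≤m i) (λ 1≡m[i] → no-trivial (i , sym 1≡m[i]))

  HasZeroSum : ∀ {k} → (Fin k → Carrier) → Set ℓ
  HasZeroSum {k} g = ∃ λ (a : Fin k → Sign G) → NonEmpty G a × wsum G k a g ≈ ε

  PMExact : ℕ → Set (c ⊔ ℓ)
  PMExact l = (g : Fin l → Carrier) → HasZeroSum g

  PMExact⇒PMProperty : ∀ {l} → PMExact l → PMProperty G l
  PMExact⇒PMProperty {l} exact k l≤k = extend (ℕ.≤⇒≤′ l≤k)
    where
    extend : ∀ {k} → l ℕ.≤′ k → (g : Fin k → Carrier) → HasZeroSum g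
    extend ℕ.≤′-refl       g = exact g
    extend (ℕ.≤′-step l≤k) g =
      let a , (j , a[j]-signed) , a·g≈ε = extend l≤k (g ∘ suc)
      in none ∷ a , (suc j , a[j]-signed) , ≈-trans (identityˡ _) a·g≈ε

  record Enumeration : Set (c ⊔ ℓ) where
    field
      size     : ℕ
      el       : Fin size → Carrier
      index    : Carrier → Fin size
      el-index : ∀ g → g ≈ el (index g)

  -- Lower bound: signed binary expansions

  signedBinary : (L : ℕ) → (Fin L → Sign G) → ℤ
  signedBinary L c = sum (λ j → coefficient (c j) ℤ.* + (2 ^ toℕ j))

  signedBinary-suc : ∀ L c → signedBinary (suc L) c ≡ coefficient (c zero) ℤ.+ + 2 ℤ.* signedBinary L (c ∘ suc)
  signedBinary-suc L c = cong₂ ℤ._+_ (ℤ.*-identityʳ (coefficient (c zero))) (begin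
    sum (λ j → coefficient (c (suc j)) ℤ.* + (2 ^ suc (toℕ j)))
      ≡⟨ sum-cong-≗ (λ j → double (coefficient (c (suc j))) (2 ^ toℕ j)) ⟩
    sum (λ j → + 2 ℤ.* term j)
      ≡⟨ *-distribˡ-sum (+ 2) term ⟨
    + 2 ℤ.* signedBinary L (c ∘ suc)
      ∎)
    where
    open ≡-Reasoning
    term : Fin L → ℤ
    term j = coefficient (c (suc j)) ℤ.* + (2 ^ toℕ j)
    double : ∀ a k → a ℤ.* + (2 * k) ≡ + 2 ℤ.* (a ℤ.* + k)
    double a k = trans (cong (a ℤ.*_) (ℤ.pos-* 2 k)) (commute a (+ k))
      where
      commute : ∀ a b → a ℤ.* (+ 2 ℤ.* b) ≡ + 2 ℤ.* (a ℤ.* b)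
      commute = solve-∀

  ∣signedBinary∣<2^L : ∀ L c → ℤ.∣ signedBinary L c ∣ < 2 ^ L
  ∣signedBinary∣<2^L zero    c = s≤s z≤n
  ∣signedBinary∣<2^L (suc L) c = begin-strict
    ℤ.∣ signedBinary (suc L) c ∣   ≡⟨ cong ℤ.∣_∣ (signedBinary-suc L c) ⟩
    ℤ.∣ s ℤ.+ + 2 ℤ.* x ∣          ≤⟨ ℤ.∣i+j∣≤∣i∣+∣j∣ s (+ 2 ℤ.* x) ⟩
    ℤ.∣ s ∣ + ℤ.∣ + 2 ℤ.* x ∣      ≡⟨ cong (λ y → ℤ.∣ s ∣ + y) (ℤ.∣i*j∣≡∣i∣*∣j∣ (+ 2) x) ⟩
    ℤ.∣ s ∣ + 2 * ℤ.∣ x ∣          ≤⟨ ℕ.+-monoˡ-≤ (2 * ℤ.∣ x ∣) (∣coefficient∣≤1 (c zero)) ⟩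
    1 + 2 * ℤ.∣ x ∣                <⟨ ℕ.n<1+n _ ⟩
    2 * 1 + 2 * ℤ.∣ x ∣            ≡⟨ ℕ.*-distribˡ-+ 2 1 ℤ.∣ x ∣ ⟨
    2 * suc ℤ.∣ x ∣                ≤⟨ ℕ.*-monoʳ-≤ 2 (∣signedBinary∣<2^L L (c ∘ suc)) ⟩
    2 ^ suc L                      ∎
    where
    open ℕ.≤-Reasoning
    s = coefficient (c zero)
    x = signedBinary L (c ∘ suc)

  signedBinary≡0⇒none : ∀ L c → signedBinary L c ≡ + 0 → ∀ j → c j ≡ none
  signedBinary≡0⇒none (suc L) c sb≡0 = λ where
      zero    → coefficient≡0⇒none (c zero) s≡0
      (suc j) → signedBinary≡0⇒none L (c ∘ suc) x≡0 j
    where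
    s = coefficient (c zero)
    x = signedBinary L (c ∘ suc)
    s≡-2x : s ≡ ℤ.- (+ 2 ℤ.* x)
    s≡-2x = begin
      s                                  ≡⟨ a≡a+b-b s (+ 2 ℤ.* x) ⟩
      s ℤ.+ + 2 ℤ.* x ℤ.- + 2 ℤ.* x      ≡⟨ cong (ℤ._- (+ 2 ℤ.* x)) (trans (sym (signedBinary-suc L c)) sb≡0) ⟩
      + 0 ℤ.- + 2 ℤ.* x                  ≡⟨ ℤ.+-identityˡ _ ⟩
      ℤ.- (+ 2 ℤ.* x)                    ∎
      where open ≡-Reasoning
    2∣x∣<2 : 2 * ℤ.∣ x ∣ < 2 * 1
    2∣x∣<2 = begin-strict
      2 * ℤ.∣ x ∣          ≡⟨ ℤ.∣i*j∣≡∣i∣*∣j∣ (+ 2) x ⟨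
      ℤ.∣ + 2 ℤ.* x ∣      ≡⟨ ℤ.∣-i∣≡∣i∣ (+ 2 ℤ.* x) ⟨
      ℤ.∣ ℤ.- (+ 2 ℤ.* x) ∣ ≡⟨ cong ℤ.∣_∣ s≡-2x ⟨
      ℤ.∣ s ∣              <⟨ s≤s (∣coefficient∣≤1 (c zero)) ⟩
      2                    ∎
      where open ℕ.≤-Reasoning
    x≡0 : x ≡ + 0
    x≡0 = ℤ.∣i∣≡0⇒i≡0 (ℕ.n<1⇒n≡0 (ℕ.*-cancelˡ-< 2 _ _ 2∣x∣<2))
    s≡0 : s ≡ + 0
    s≡0 = trans s≡-2x (cong (λ y → ℤ.- (+ 2 ℤ.* y)) x≡0)

  signedBinary≡[]0⇒none : ∀ {m} L c → 2 ^ L ≤ m → signedBinary L c ≡[ m ] + 0 → ∀ j → c j ≡ none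
  signedBinary≡[]0⇒none L c 2^L≤m sb≡0 =
    signedBinary≡0⇒none L c (≡[]0∧small⇒≡0 sb≡0 (ℕ.<-≤-trans (∣signedBinary∣<2^L L c) 2^L≤m))

  combination-++ : ∀ {A B t} (a : Fin (A + B) → Sign G) (u : Fin A → Fin t → ℤ) (v : Fin B → Fin t → ℤ) i →
                   combination a (u ++ v) i ≡ combination (a ∘ (Fin._↑ˡ B)) u i ℤ.+ combination (a ∘ (A Fin.↑ʳ_)) v i
  combination-++ {A} {B} a u v i = trans (sum-split A B _) (cong₂ ℤ._+_
    (sum-cong-≗ (λ j → cong (λ w → coefficient (a (j Fin.↑ˡ B)) ℤ.* w i) (lookup-++ˡ u v j)))
    (sum-cong-≗ (λ k → cong (λ w → coefficient (a (A Fin.↑ʳ k)) ℤ.* w i) (lookup-++ʳ u v k))))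

  combination-zero : ∀ {k t} (a : Fin k → Sign G) (v : Fin k → Fin t → ℤ) i → (∀ j → v j i ≡ + 0) → combination a v i ≡ + 0
  combination-zero {k} a v i v≡0 = sum-zero k (λ j → trans (cong (coefficient (a j) ℤ.*_) (v≡0 j)) (ℤ.*-zeroʳ (coefficient (a j))))

  powerSequence-independent : ∀ t (L : Fin t → ℕ) {m : Fin t → ℕ} → (∀ i → 2 ^ L i ≤ m i) →
    ∀ s → (∀ i → combination s (powerSequence t L) i ≡[ m i ] + 0) → ∀ k → s k ≡ none
  powerSequence-independent (suc t) L {m} 2^L≤m s s·ps≡0 k =
    subst (λ k → s k ≡ none) (Fin.join-splitAt A B k)
      (Sum.[_,_] {C = λ x → s (Fin.join A B x) ≡ none} first rest (Fin.splitAt A k))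
    where
    A = L zero
    B = sumℕ t (L ∘ suc)
    powers : Fin A → Fin (suc t) → ℤ
    powers j = + (2 ^ toℕ j) ∷ replicate t (+ 0)
    shifted : Fin B → Fin (suc t) → ℤ
    shifted k = + 0 ∷ powerSequence t (L ∘ suc) k
    left  = s ∘ (Fin._↑ˡ B)
    right = s ∘ (A Fin.↑ʳ_)
    first : ∀ j → left j ≡ none
    first = signedBinary≡[]0⇒none A left (2^L≤m zero) (subst (_≡[ m zero ] + 0) coordinate₀ (s·ps≡0 zero))
      where
      open ≡-Reasoning
      coordinate₀ : combination s (powers ++ shifted) zero ≡ signedBinary A left
      coordinate₀ = begin
        combination s (powers ++ shifted) zero
          ≡⟨ combination-++ s powers shifted zero ⟩
        signedBinary A left ℤ.+ combination right shifted zero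
          ≡⟨ cong (λ y → signedBinary A left ℤ.+ y) (combination-zero right shifted zero (λ _ → refl)) ⟩
        signedBinary A left ℤ.+ + 0
          ≡⟨ ℤ.+-identityʳ _ ⟩
        signedBinary A left
          ∎
    rest : ∀ k → right k ≡ none
    rest = powerSequence-independent t (L ∘ suc) (2^L≤m ∘ suc) right
      (λ i → subst (_≡[ m (suc i) ] + 0) (coordinate i) (s·ps≡0 (suc i)))
      where
      open ≡-Reasoning
      coordinate : ∀ i → combination s (powers ++ shifted) (suc i) ≡ combination right (powerSequence t (L ∘ suc)) i
      coordinate i = begin
        combination s (powers ++ shifted) (suc i)
          ≡⟨ combination-++ s powers shifted (suc i) ⟩
        combination left powers (suc i) ℤ.+ combination right shifted (suc i)
          ≡⟨ cong (λ y → y ℤ.+ combination right shifted (suc i)) (combination-zero left powers (suc i) (λ _ → refl)) ⟩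
        + 0 ℤ.+ combination right (powerSequence t (L ∘ suc)) i
          ≡⟨ ℤ.+-identityˡ _ ⟩
        combination right (powerSequence t (L ∘ suc)) i
          ∎

  -- Upper bound: pigeonhole on subset sums

  indicator : Fin 2 → Sign G
  indicator zero       = none
  indicator (suc zero) = plus

  difference : Fin 2 → Fin 2 → Sign G
  difference zero       zero       = none
  difference zero       (suc zero) = minus
  difference (suc zero) zero       = plus
  difference (suc zero) (suc zero) = none

  difference-act : ∀ x y g → act G (difference x y) g ∙ act G (indicator y) g ≈ act G (indicator x) g
  difference-act zero       zero       g = identityˡ ε
  difference-act zero       (suc zero) g = inverseˡ g
  difference-act (suc zero) zero       g = identityʳ g
  difference-act (suc zero) (suc zero) g = identityˡ g

  difference≢none : ∀ {x y} → x ≢ y → (difference x y ≡ minus) ⊎ (difference x y ≡ plus)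
  difference≢none {zero}     {zero}     x≢y = ⊥-elim (x≢y refl)
  difference≢none {zero}     {suc zero} _   = inj₁ refl
  difference≢none {suc zero} {zero}     _   = inj₂ refl
  difference≢none {suc zero} {suc zero} x≢y = ⊥-elim (x≢y refl)

  -- Two of the 2^B subset sums get the same code, hence are equal; the signed difference of the
  -- two subsets is the zero sum.
  PMExact-of-injection : ∀ {K B} (code : Carrier → Fin K) → (∀ {x y} → code x ≡ code y → x ≈ y) →
                         K < 2 ^ B → PMExact B
  PMExact-of-injection {K} {B} code code-injective K<2^B g = a , (j , difference≢none subsets-differ) , a·g≈ε
    where
    subset : Fin (2 ^ B) → Fin B → Fin 2
    subset = Fin.finToFun
    subsetSum : Fin (2 ^ B) → Carrier
    subsetSum s = wsum G B (indicator ∘ subset s) g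
    collision = Fin.pigeonhole K<2^B (code ∘ subsetSum)
    x = proj₁ collision
    y = proj₁ (proj₂ collision)
    a : Fin B → Sign G
    a j = difference (subset x j) (subset y j)
    distinct = Fin.¬∀⟶∃¬ B _ (λ j → subset x j Fin.≟ subset y j)
                 (λ x≗y → Fin.<⇒≢ (proj₁ (proj₂ (proj₂ collision))) (finToFun-injective x≗y))
    j = proj₁ distinct
    subsets-differ = proj₂ distinct
    a·g≈ε : wsum G B a g ≈ ε
    a·g≈ε = identityˡ-unique _ (subsetSum y) (≈-trans
      (wsum-∙ B a (indicator ∘ subset y) (indicator ∘ subset x) g (λ j → difference-act (subset x j) (subset y j) (g j)))
      (code-injective (proj₂ (proj₂ (proj₂ collision)))))

  module _ {t} {m : Fin t → ℕ} (J : Iso G t m) (1≤m : ∀ i → 1 ≤ m i) where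
    open Iso J
    open IsoProperties J

    PMProperty⇒logSum≤ : ∀ {l} → PMProperty G l → logSum G t m ≤ l
    PMProperty⇒logSum≤ {l} pm = ℕ.≮⇒≥ λ l<K+1 →
      let a , nonEmpty , a·g≈ε = pm K (ℕ.m<1+n⇒m≤n (subst (l <_) (ℕ.+-comm K 1) l<K+1)) g
      in NonEmpty⇒¬all-none nonEmpty (powerSequence-independent t L (λ i → 2^⌊log₂n⌋≤n (m i) (1≤m i)) a (a·ps≡0 a a·g≈ε))
      where
      L = λ i → ⌊log₂ m i ⌋
      K = sumℕ t L
      g : Fin K → Carrier
      g k = section (powerSequence t L k)
      a·ps≡0 : ∀ a → wsum G K a g ≈ ε → ∀ i → combination a (powerSequence t L) i ≡[ m i ] + 0
      a·ps≡0 a a·g≈ε i = begin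
        combination a (powerSequence t L) i   ≈⟨ sum-≡[] K (λ k → *-congˡ-≡[] (coefficient (a k)) (f-section (powerSequence t L k) i)) ⟨
        combination a (f ∘ g) i               ≈⟨ f-wsum K a g i ⟨
        f (wsum G K a g) i                    ≈⟨ f-cong-at a·g≈ε i ⟩
        f ε i                                 ≈⟨ f-ε i ⟩
        + 0                                   ∎
        where open ≈-Reasoning (≡[]-setoid (m i))

    residueAt : Carrier → (i : Fin t) → Fin (m i)
    residueAt g i = proj₁ (residue (1≤m i) ℕ.≤-refl (f g i))

    residueAt-≡[] : ∀ g i → + toℕ (residueAt g i) ≡[ m i ] f g i
    residueAt-≡[] g i = proj₂ (residue (1≤m i) ℕ.≤-refl (f g i))

    residueCode : Carrier → Fin (∏ t m)
    residueCode g = ∏-combine t (residueAt g)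

    residueCode-injective : ∀ {x y} → residueCode x ≡ residueCode y → x ≈ y
    residueCode-injective {x} {y} same = f-inj-at λ i → let open ≈-Reasoning (≡[]-setoid (m i)) in begin
      f x i                     ≈⟨ residueAt-≡[] x i ⟨
      + toℕ (residueAt x i)     ≡⟨ cong (λ w → + toℕ w) (∏-combine-injective t (residueAt x) (residueAt y) same i) ⟩
      + toℕ (residueAt y i)     ≈⟨ residueAt-≡[] y i ⟩
      f y i                     ∎

    PMProperty-Σ⌊log₂⌋+t : 1 ≤ t → PMProperty G (Σ⌊log₂⌋ t m + t)
    PMProperty-Σ⌊log₂⌋+t 1≤t = PMExact⇒PMProperty (PMExact-of-injection residueCode residueCode-injective (begin-strict
      ∏ t m                                 <⟨ ∏-mono-< t 1≤t (λ i → n<2^[1+⌊log₂n⌋] (m i)) ⟩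
      ∏ t (λ i → 2 ^ suc ⌊log₂ m i ⌋)       ≡⟨ ∏-2^ t (λ i → suc ⌊log₂ m i ⌋) ⟩
      2 ^ sumℕ t (λ i → suc ⌊log₂ m i ⌋)    ≡⟨ cong (2 ^_) (sumℕ-suc t (λ i → ⌊log₂ m i ⌋)) ⟩
      2 ^ (Σ⌊log₂⌋ t m + t)                 ∎))
      where open ℕ.≤-Reasoning

    1≤Σ⌊log₂⌋+t : 1 ≤ t → 1 ≤ Σ⌊log₂⌋ t m + t
    1≤Σ⌊log₂⌋+t 1≤t = ℕ.≤-trans 1≤t (ℕ.m≤n+m t _)

    Dpm≤Dstar+t∸1 : 1 ≤ t → ∀ {d D} → IsDstar G d → IsDpm G D → D ≤ d + t ∸ 1
    Dpm≤Dstar+t∸1 1≤t {d} {D} (_ , maximal) (_ , _ , minimal) = begin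
      D                       ≤⟨ minimal (Σ⌊log₂⌋ t m + t) (1≤Σ⌊log₂⌋+t 1≤t) (PMProperty-Σ⌊log₂⌋+t 1≤t) ⟩
      Σ⌊log₂⌋ t m + t         ≡⟨ cong (_∸ 1) (trans (ℕ.+-assoc (Σ⌊log₂⌋ t m) 1 t) (ℕ.+-suc (Σ⌊log₂⌋ t m) t)) ⟨
      logSum G t m + t ∸ 1    ≤⟨ ℕ.∸-monoˡ-≤ 1 (ℕ.+-monoˡ-≤ t (maximal t m 1≤m J)) ⟩
      d + t ∸ 1               ∎
      where open ℕ.≤-Reasoning

    enumeration : Enumeration
    enumeration = record { size = N ^ t ; el = el ; index = index ; el-index = el-index }
      where
      N = ∏ t m
      el : Fin (N ^ t) → Carrier
      el c = section ⟦ Fin.finToFun c ⟧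
      representative : Carrier → Fin t → Fin N
      representative g = proj₁ (residues 1≤m (∏-≥-factor t 1≤m) (f g))
      index : Carrier → Fin (N ^ t)
      index g = Fin.funToFin (representative g)
      el-index : ∀ g → g ≈ el (index g)
      el-index g = f-inj-at λ i → let open ≈-Reasoning (≡[]-setoid (m i)) in begin
        f g i                                   ≈⟨ ≋⇒≡[] {x = ⟦ representative g ⟧} {f g}
                                                       (proj₂ (residues 1≤m (∏-≥-factor t 1≤m) (f g))) i ⟨
        + toℕ (representative g i)              ≡⟨ cong (λ w → + toℕ w) (Fin.finToFun-funToFin (representative g) i) ⟨
        + toℕ (Fin.finToFun (index g) i)        ≈⟨ f-section ⟦ Fin.finToFun (index g) ⟧ i ⟨
        f (el (index g)) i                      ∎

  Dstar≤Dpm : ∀ {d D} → IsDstar G d → IsDpm G D → d ≤ D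
  Dstar≤Dpm ((t , m , 1≤m , J , refl) , _) (_ , pm , _) = PMProperty⇒logSum≤ J 1≤m pm

  -- Existence of D± and D*±

  sign : Fin 3 → Sign G
  sign zero             = minus
  sign (suc zero)       = none
  sign (suc (suc zero)) = plus

  signCode : Sign G → Fin 3
  signCode minus = zero
  signCode none  = suc zero
  signCode plus  = suc (suc zero)

  sign-signCode : ∀ s → sign (signCode s) ≡ s
  sign-signCode minus = refl
  sign-signCode none  = refl
  sign-signCode plus  = refl

  isSigned? : (s : Sign G) → Dec ((s ≡ minus) ⊎ (s ≡ plus))
  isSigned? minus = yes (inj₁ refl)
  isSigned? none  = no λ { (inj₁ ()) ; (inj₂ ()) }
  isSigned? plus  = yes (inj₂ refl)

  module Enumerated (E : Enumeration) (_≈?_ : ∀ x y → Dec (x ≈ y)) where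
    open Enumeration E

    PMExact? : ∀ l → Dec (PMExact l)
    PMExact? l = Dec.map′ fromCodes toCodes
      (Fin.all? λ c → Fin.any? λ s → Fin.any? (λ j → isSigned? (signs s j)) ×-dec (wsum G l (signs s) (elements c) ≈? ε))
      where
      signs : Fin (3 ^ l) → Fin l → Sign G
      signs s = sign ∘ Fin.finToFun s
      elements : Fin (size ^ l) → Fin l → Carrier
      elements c = el ∘ Fin.finToFun c
      ZeroSumCode : Fin (size ^ l) → Set ℓ
      ZeroSumCode c = ∃ λ s → NonEmpty G (signs s) × wsum G l (signs s) (elements c) ≈ ε
      fromCodes : (∀ c → ZeroSumCode c) → PMExact l
      fromCodes zeroSum g = signs s , nonEmpty , ≈-trans (wsum-cong l (signs s) g≈elements) a·elements≈ε
        where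
        code = Fin.funToFin (index ∘ g)
        s = proj₁ (zeroSum code)
        nonEmpty = proj₁ (proj₂ (zeroSum code))
        a·elements≈ε = proj₂ (proj₂ (zeroSum code))
        g≈elements : ∀ j → g j ≈ elements code j
        g≈elements j = ≈-trans (el-index (g j)) (reflexive (cong el (sym (Fin.finToFun-funToFin (index ∘ g) j))))
      toCodes : PMExact l → ∀ c → ZeroSumCode c
      toCodes exact c = s , NonEmpty-congˢ (λ j → sym (signs≗a j)) nonEmpty
                          , subst (_≈ ε) (sym (wsum-congˢ l (elements c) signs≗a)) a·elements≈ε
        where
        a = proj₁ (exact (elements c))
        nonEmpty = proj₁ (proj₂ (exact (elements c)))
        a·elements≈ε = proj₂ (proj₂ (exact (elements c)))
        s = Fin.funToFin (signCode ∘ a)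
        signs≗a : ∀ j → signs s j ≡ a j
        signs≗a j = trans (cong sign (Fin.finToFun-funToFin (signCode ∘ a) j)) (sign-signCode (a j))

    PMProperty? : ∀ l → Dec (PMProperty G l)
    PMProperty? l = Dec.map′ PMExact⇒PMProperty (λ pm → pm l ℕ.≤-refl) (PMExact? l)

    Dpm-exists : ∀ {B} → 1 ≤ B → PMProperty G B → ∃ (IsDpm G)
    Dpm-exists {suc B} _ pm =
      let k , PMk , minimal = least (λ j → PMProperty? (suc j)) pm
      in suc k , s≤s z≤n , PMk , λ { (suc l) _ PMl → s≤s (minimal PMl) }

    module _ {t} (μ : Fin t → ℕ) (T : Fin size → Fin t → Fin size) where

      Respects Reflects : Set ℓ
      Respects = ∀ k k′ → el k ≈ el k′ → ⟦ T k ⟧ ≋[ μ ] ⟦ T k′ ⟧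
      Reflects = ∀ k k′ → ⟦ T k ⟧ ≋[ μ ] ⟦ T k′ ⟧ → el k ≈ el k′

      Additive Onto : Set
      Additive = ∀ k k′ → ⟦ T (index (el k ∙ el k′)) ⟧ ≋[ μ ] (⟦ T k ⟧ +ᵛ ⟦ T k′ ⟧)
      Onto     = ∀ w → ∃ λ k → ⟦ T k ⟧ ≋[ μ ] ⟦ Fin.finToFun {size} {t} w ⟧

      IsCoordinateTable : Set ℓ
      IsCoordinateTable = Respects × Additive × Reflects × Onto

      IsCoordinateTable? : Dec IsCoordinateTable
      IsCoordinateTable? =
        (Fin.all? λ k → Fin.all? λ k′ → (el k ≈? el k′) →-dec (⟦ T k ⟧ ≋? ⟦ T k′ ⟧)) ×-dec
        (Fin.all? λ k → Fin.all? λ k′ → ⟦ T (index (el k ∙ el k′)) ⟧ ≋? (⟦ T k ⟧ +ᵛ ⟦ T k′ ⟧)) ×-dec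
        (Fin.all? λ k → Fin.all? λ k′ → (⟦ T k ⟧ ≋? ⟦ T k′ ⟧) →-dec (el k ≈? el k′)) ×-dec
        (Fin.all? λ w → Fin.any? λ k → ⟦ T k ⟧ ≋? ⟦ Fin.finToFun w ⟧)

      table⇒Iso : (∀ i → 1 ≤ μ i) → (∀ i → μ i ≤ size) → IsCoordinateTable → Iso G t μ
      table⇒Iso 1≤μ μ≤size (respects , additive , reflects , onto) = record
        { f      = coordinates
        ; f-cong = λ {x} {y} x≈y → respects (index x) (index y) (≈-trans (≈-sym (el-index x)) (≈-trans x≈y (el-index y)))
        ; f-hom  = hom
        ; f-inj  = λ {x} {y} cx≋cy → ≈-trans (el-index x) (≈-trans (reflects (index x) (index y) cx≋cy) (≈-sym (el-index y)))
        ; f-surj = surj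
        }
        where
        open ≈-Reasoning (≋-setoid μ)
        coordinates : Carrier → Fin t → ℤ
        coordinates g = ⟦ T (index g) ⟧
        hom : ∀ x y → coordinates (x ∙ y) ≋[ μ ] (coordinates x +ᵛ coordinates y)
        hom x y = begin
          ⟦ T (index (x ∙ y)) ⟧                            ≈⟨ respects _ _ (≈-trans (≈-sym (el-index (x ∙ y)))
                                                                (≈-trans (∙-cong (el-index x) (el-index y)) (el-index _))) ⟩
          ⟦ T (index (el (index x) ∙ el (index y))) ⟧      ≈⟨ additive (index x) (index y) ⟩
          ⟦ T (index x) ⟧ +ᵛ ⟦ T (index y) ⟧               ∎
        surj : ∀ v → Σ Carrier λ x → coordinates x ≋[ μ ] v
        surj v = el k , (begin
          ⟦ T (index (el k)) ⟧                  ≈⟨ respects _ _ (≈-sym (el-index (el k))) ⟩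
          ⟦ T k ⟧                               ≈⟨ proj₂ (onto (Fin.funToFin w)) ⟩
          ⟦ Fin.finToFun (Fin.funToFin w) ⟧     ≈⟨ ≋-reflexive (λ i → cong (λ j → + toℕ j) (Fin.finToFun-funToFin w i)) ⟩
          ⟦ w ⟧                                 ≈⟨ proj₂ (residues 1≤μ μ≤size v) ⟩
          v                                     ∎)
          where
          w = proj₁ (residues 1≤μ μ≤size v)
          k = proj₁ (onto (Fin.funToFin w))

      Iso⇒table : (J : Iso G t μ) → (∀ k → ⟦ T k ⟧ ≋[ μ ] Iso.f J (el k)) → IsCoordinateTable
      Iso⇒table J T≋f = respects , additive , reflects , onto
        where
        open Iso J
        open ≈-Reasoning (≋-setoid μ)
        respects : Respects
        respects k k′ el-k≈el-k′ = begin
          ⟦ T k ⟧      ≈⟨ T≋f k ⟩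
          f (el k)     ≈⟨ f-cong el-k≈el-k′ ⟩
          f (el k′)    ≈⟨ T≋f k′ ⟨
          ⟦ T k′ ⟧     ∎
        additive : Additive
        additive k k′ = begin
          ⟦ T (index (el k ∙ el k′)) ⟧      ≈⟨ T≋f _ ⟩
          f (el (index (el k ∙ el k′)))     ≈⟨ f-cong (el-index (el k ∙ el k′)) ⟨
          f (el k ∙ el k′)                  ≈⟨ f-hom (el k) (el k′) ⟩
          f (el k) +ᵛ f (el k′)             ≈⟨ +ᵛ-cong-≋ {x = ⟦ T k ⟧} {f (el k)} {⟦ T k′ ⟧} {f (el k′)}
                                                           (T≋f k) (T≋f k′) ⟨
          ⟦ T k ⟧ +ᵛ ⟦ T k′ ⟧               ∎
        reflects : Reflects
        reflects k k′ Tk≋Tk′ = f-inj (begin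
          f (el k)     ≈⟨ T≋f k ⟨
          ⟦ T k ⟧      ≈⟨ Tk≋Tk′ ⟩
          ⟦ T k′ ⟧     ≈⟨ T≋f k′ ⟩
          f (el k′)    ∎)
        onto : Onto
        onto w = index x , (begin
          ⟦ T (index x) ⟧                ≈⟨ T≋f (index x) ⟩
          f (el (index x))               ≈⟨ f-cong (el-index x) ⟨
          f x                            ≈⟨ proj₂ (f-surj ⟦ Fin.finToFun w ⟧) ⟩
          ⟦ Fin.finToFun w ⟧             ∎)
          where x = proj₁ (f-surj ⟦ Fin.finToFun w ⟧)

    modulus≤size : ∀ {t} {m : Fin t → ℕ} → Iso G t m → ∀ i → m i ≤ size
    modulus≤size {m = m} J i = Fin.injective⇒≤ {f = position} position-injective
      where
      open Iso J
      open IsoProperties J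
      constant : Fin (m i) → Fin _ → ℤ
      constant j _ = + toℕ j
      position : Fin (m i) → Fin size
      position j = index (section (constant j))
      position-injective : ∀ {j j′} → position j ≡ position j′ → j ≡ j′
      position-injective {j} {j′} same = Fin.toℕ-injective (≡[]-canonical congruent (Fin.toℕ<n j) (Fin.toℕ<n j′))
        where
        open ≈-Reasoning (≡[]-setoid (m i))
        congruent : + toℕ j ≡[ m i ] + toℕ j′
        congruent = begin
          + toℕ j                    ≈⟨ f-section (constant j) i ⟨
          f (section (constant j)) i  ≈⟨ f-cong-at (≈-trans (el-index _)
                                           (≈-trans (reflexive (cong el same)) (≈-sym (el-index _)))) i ⟩
          f (section (constant j′)) i ≈⟨ f-section (constant j′) i ⟩
          + toℕ j′                   ∎

    Decomposable : ℕ → Set (c ⊔ ℓ)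
    Decomposable v = ∃ λ t → ∃ λ (m : Fin t → ℕ) → (∀ i → 1 ≤ m i) × Iso G t m × logSum G t m ≡ v

    -- A decomposition with all moduli ≥ 2 has fewer than logSum factors, each of order at most size
    -- (modulus≤size), and it is determined up to equivalence by the coordinates it assigns to the
    -- enumerated elements. Coding the moduli and this table by elements of Fin makes the search finite.
    moduli : ∀ t → Fin (suc size ^ t) → Fin t → ℕ
    moduli t mc = toℕ ∘ Fin.finToFun mc

    table : ∀ t → Fin ((size ^ t) ^ size) → Fin size → Fin t → Fin size
    table t Tc k = Fin.finToFun (Fin.finToFun Tc k)

    Tabulated : ℕ → Set ℓ
    Tabulated v = ∃ λ t → t < v × ∃ λ (mc : Fin (suc size ^ t)) → ∃ λ (Tc : Fin ((size ^ t) ^ size)) →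
      (∀ i → 2 ≤ moduli t mc i) × IsCoordinateTable (moduli t mc) (table t Tc) × logSum G t (moduli t mc) ≡ v

    Tabulated? : ∀ v → Dec (Tabulated v)
    Tabulated? v = ℕ.anyUpTo? (λ t → Fin.any? λ mc → Fin.any? λ Tc →
      Fin.all? (λ i → 2 ℕ.≤? moduli t mc i) ×-dec
      IsCoordinateTable? (moduli t mc) (table t Tc) ×-dec
      (logSum G t (moduli t mc) ℕ.≟ v)) v

    Tabulated⇒Decomposable : ∀ {v} → Tabulated v → Decomposable v
    Tabulated⇒Decomposable (t , _ , mc , Tc , 2≤m , isTable , logSum≡v) =
      t , moduli t mc , 1≤m , table⇒Iso (moduli t mc) (table t Tc) 1≤m m≤size isTable , logSum≡v
      where
      1≤m = λ i → ℕ.<⇒≤ (2≤m i)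
      m≤size = λ i → ℕ.m<1+n⇒m≤n (Fin.toℕ<n (Fin.finToFun mc i))

    Iso⇒Tabulated : ∀ {t} {m : Fin t → ℕ} → Iso G t m → (∀ i → 2 ≤ m i) → Tabulated (logSum G t m)
    Iso⇒Tabulated {t} {m} J 2≤m =
      t , t<logSum , mc , Tc , 2≤moduli , isTable , cong (λ s → s + 1) (sumℕ-cong t (cong ⌊log₂_⌋ ∘ moduli≗m))
      where
      mc = Fin.funToFin (λ i → Fin.fromℕ< (s≤s (modulus≤size J i)))
      moduli≗m : ∀ i → moduli t mc i ≡ m i
      moduli≗m i = trans (cong toℕ (Fin.finToFun-funToFin _ i)) (Fin.toℕ-fromℕ< _)
      2≤moduli = λ i → subst (2 ≤_) (sym (moduli≗m i)) (2≤m i)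
      J′ = Iso-transport (sym ∘ moduli≗m) J
      coordinatesOf : (k : Fin size) → Σ (Fin t → Fin size) λ w → ⟦ w ⟧ ≋[ moduli t mc ] Iso.f J′ (el k)
      coordinatesOf k =
        residues (λ i → ℕ.<⇒≤ (2≤moduli i)) (λ i → ℕ.m<1+n⇒m≤n (Fin.toℕ<n (Fin.finToFun mc i))) (Iso.f J′ (el k))
      T : Fin size → Fin t → Fin size
      T k = proj₁ (coordinatesOf k)
      Tc = Fin.funToFin (λ k → Fin.funToFin (T k))
      table≗T : ∀ k i → table t Tc k i ≡ T k i
      table≗T k i = trans (cong (λ w → Fin.finToFun w i) (Fin.finToFun-funToFin (λ k → Fin.funToFin (T k)) k))
                          (Fin.finToFun-funToFin (T k) i)
      isTable = Iso⇒table (moduli t mc) (table t Tc) J′ λ k → begin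
        ⟦ table t Tc k ⟧     ≈⟨ ≋-reflexive (λ i → cong (λ w → + toℕ w) (table≗T k i)) ⟩
        ⟦ T k ⟧              ≈⟨ proj₂ (coordinatesOf k) ⟩
        Iso.f J′ (el k)      ∎
        where open ≈-Reasoning (≋-setoid (moduli t mc))
      t<logSum : t < logSum G t m
      t<logSum = subst (t <_) (ℕ.+-comm 1 _) (s≤s (sumℕ-≥-length t (λ i → 1≤⌊log₂⌋ (2≤m i))))

    Decomposable⇒Tabulated : ∀ {v} → Decomposable v → Tabulated v
    Decomposable⇒Tabulated (t , m , 1≤m , J , refl) =
      let _ , _ , J′ , 2≤m′ , same = dropTrivialFactors t m J 1≤m
      in subst Tabulated same (Iso⇒Tabulated J′ 2≤m′)

    Decomposable? : ∀ v → Dec (Decomposable v)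
    Decomposable? v = Dec.map′ Tabulated⇒Decomposable Decomposable⇒Tabulated (Tabulated? v)

    Dstar-exists : ∀ {t} {m : Fin t → ℕ} → Iso G t m → (∀ i → 1 ≤ m i) → ∀ {D} → PMProperty G D → ∃ (IsDstar G)
    Dstar-exists J 1≤m {D} pm =
      let d , decomposable , maximal = greatest Decomposable? (_ , _ , 1≤m , J , refl) bounded
      in d , decomposable , λ t m 1≤m J → maximal (t , m , 1≤m , J , refl)
      where
      bounded : ∀ {v} → Decomposable v → v ≤ D
      bounded (t , m , 1≤m , J , refl) = PMProperty⇒logSum≤ J 1≤m pm

  module Constants {t} {m : Fin t → ℕ} (J : Iso G t m) (1≤m : ∀ i → 1 ≤ m i) (1≤t : 1 ≤ t) where
    open Enumerated (enumeration J 1≤m) (IsoProperties._≈?_ J)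

    Dpm : ∃ (IsDpm G)
    Dpm = Dpm-exists (1≤Σ⌊log₂⌋+t J 1≤m 1≤t) (PMProperty-Σ⌊log₂⌋+t J 1≤m 1≤t)

    Dstar : ∃ (IsDstar G)
    Dstar = Dstar-exists J 1≤m (PMProperty-Σ⌊log₂⌋+t J 1≤m 1≤t)

-- The divisibility chain n₀ ∣ n₁ ∣ ⋯ only makes r the rank of G; the bounds hold for every decomposition.
corollary3p4 : {c ℓ : Level} (G : AbelianGroup c ℓ) (r : ℕ) (n : Fin r → ℕ) →
    1 ≤ r → (∀ i → 2 ≤ n i) → (∀ i j → toℕ i ≤ toℕ j → n i ∣ n j) → Iso G r n →
    ∃ λ d → ∃ λ D → IsDstar G d × IsDpm G D × d ≤ D × D ≤ d + r ∸ 1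
corollary3p4 G r n 1≤r 2≤n _ I =
  let D , isDpm = Dpm
      d , isDstar = Dstar
  in d , D , isDstar , isDpm , Dstar≤Dpm G isDstar isDpm , Dpm≤Dstar+t∸1 G I 1≤n 1≤r isDstar isDpm
  where
  1≤n = λ i → ℕ.<⇒≤ (2≤n i)
  open Constants G I 1≤n 1≤r
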